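{- Let $\mathbf{\Psi}$ be a finite set of polymers over a finite set of monomers $\mathbf{\Psi^0}$, and let $\mathcal S\subseteq\mathbf{\Psi}$ be TBN-stability closed and such that for every $P\in\mathbf{\Psi}$ there are $M\in\mathbb{N}^{\mathcal S}$ and $M'\in\mathbb{N}^{\mathbf{\Psi}}$ with $P\in M'$ and $M\cong M'$. Then $\mathcal S$ with $\mu(P)=1$ for all $P\in\mathcal S$ is an on-target set, and it is stable.
   Context: Multisets: a multiset $M$ over a finite set $A$ is a function $A\to\mathbb{N}$, $M[a]$ the count of $a$, $a\in M$ means $M[a]\ge1$, $|M|=\sum_aM[a]$, $M_1-M_2$ pointwise difference (when defined), $M\cap S$ agrees with $M$ on $S$ and is $0$ elsewhere; $\mathbb{N}^S$ denotes multisets over $S$. Setting: $\mathbf{\Psi}\subseteq\mathbb{N}^{\mathbf{\Psi^0}}$. $M_1,M_2\in\mathbb{N}^{\mathbf{\Psi}}$ are reconfigurations, $M_1\cong M_2$, if for every monomer $m$, $\sum_PM_1[P]P[m]=\sum_PM_2[P]P[m]$; then $M_1\to M_2$ is a reaction. A multiset $M\in\mathbb{N}^{\mathbf{\Psi}}$ is TBN-stable if every reaction $M\to M'$ ($M'\in\mathbb{N}^{\mathbf{\Psi}}$) has $|M|\ge|M'|$. $\mathcal S$ is TBN-stability closed if every $M\in\mathbb{N}^{\mathcal S}$ is TBN-stable and every reaction $M\to M'$ with $M\in\mathbb{N}^{\mathcal S}$ and $M'$ containing some polymer not in $\mathcal S$ satisfies $|M|>|M'|$. On-target set: $\mathcal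 S$ with $\mu:\mathcal S\to(0,1]$ such that (1) every $P\in\mathbf{\Psi}$ lies in some $M'$ with $M\cong M'$ for some $M\in\mathbb{N}^{\mathcal S}$; (2) $\mu(M_1)=\mu(M_2)$ whenever $M_1,M_2\in\mathbb{N}^{\mathcal S}$, $M_1\cong M_2$, where $\mu(M)=\sum_PM[P]\mu(P)$. A reaction $M_1\to M_2$ is canonical if $M_1\in\mathbb{N}^{\mathcal S}$; $k(\alpha)=\mu(M_1)-\mu(M_2\cap\mathcal S)$, $l(\alpha)=|M_2-(M_2\cap\mathcal S)|$. The on-target set is stable if $k(\alpha)/l(\alpha)>1$ for every canonical $\alpha$ with $l(\alpha)\neq0$. -}

module Defs where

open import Data.Nat as ℕ using (ℕ; zero; suc; _+_; _*_; _∸_; _≤_; _<_)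
open import Data.Fin using (Fin; zero; suc)
open import Data.Fin.Subset using (Subset; _∈_; _∉_)
open import Data.Fin.Subset.Properties using (_∈?_)
open import Data.Bool using (if_then_else_)
open import Data.Product using (Σ; _×_; ∃)
open import Relation.Nullary using (¬_; does)
open import Relation.Binary.PropositionalEquality using (_≡_; _≢_)
import Data.Integer
open import Data.Rational as ℚ using (ℚ; 0ℚ; 1ℚ)

sumFin : (n : ℕ) → (Fin n → ℕ) → ℕ
sumFin zero    f = 0
sumFin (suc n) f = f zero + sumFin n (λ i → f (suc i))

sumFinℚ : (n : ℕ) → (Fin n → ℚ) → ℚ
sumFinℚ zero    f = 0ℚ
sumFinℚ (suc n) f = f zero ℚ.+ sumFinℚ n (λ i → f (suc i))

-- Monomers: Fin m.  A polymer is a multiset of monomers.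
Polymer : ℕ → Set
Polymer m = Fin m → ℕ

-- A finite set Ψ of polymers over Fin m, enumerated injectively by Fin n.
record PolymerSet (m n : ℕ) : Set where
  field
    poly     : Fin n → Polymer m
    distinct : ∀ i j → (∀ a → poly i a ≡ poly j a) → i ≡ j
open PolymerSet public

-- Multisets of polymers (elements of ℕ^Ψ).
MSet : ℕ → Set
MSet n = Fin n → ℕ

size : ∀ {n} → MSet n → ℕ
size {n} M = sumFin n M

_∈M_ : ∀ {n} → Fin n → MSet n → Set
i ∈M M = 1 ≤ M i

InN^ : ∀ {n} → Subset n → MSet n → Set
InN^ S M = ∀ i → i ∉ S → M i ≡ 0

_∩S_ : ∀ {n} → MSet n → Subset n → MSet n
(M ∩S S) i = if does (i ∈? S) then M i else 0

_−M_ : ∀ {n} → MSet n → MSet n → MSet n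
(M₁ −M M₂) i = M₁ i ∸ M₂ i

Reconf : ∀ {m n} → PolymerSet m n → MSet n → MSet n → Set
Reconf {m} {n} Ψ M₁ M₂ =
  ∀ (a : Fin m) → sumFin n (λ i → M₁ i * poly Ψ i a) ≡ sumFin n (λ i → M₂ i * poly Ψ i a)

TBNStable : ∀ {m n} → PolymerSet m n → MSet n → Set
TBNStable Ψ M = ∀ M′ → Reconf Ψ M M′ → size M′ ≤ size M

TBNStabilityClosed : ∀ {m n} → PolymerSet m n → Subset n → Set
TBNStabilityClosed Ψ S =
  (∀ M → InN^ S M → TBNStable Ψ M) ×
  (∀ M M′ → InN^ S M → Reconf Ψ M M′ → (∃ λ i → i ∉ S × i ∈M M′) → size M′ < size M)

Covers : ∀ {m n} → PolymerSet m n → Subset n → Set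
Covers Ψ S = ∀ P → Σ (MSet _) λ M → Σ (MSet _) λ M′ → InN^ S M × Reconf Ψ M M′ × P ∈M M′

-- μ extended to multisets over S (μ is only consulted on S).
μM : ∀ {n} → (Fin n → ℚ) → MSet n → ℚ
μM {n} μ M = sumFinℚ n (λ i → (Data.Integer.+ M i ℚ./ 1) ℚ.* μ i)

OnTarget : ∀ {m n} → PolymerSet m n → Subset n → (Fin n → ℚ) → Set
OnTarget Ψ S μ =
  (∀ i → i ∈ S → (0ℚ ℚ.< μ i) × (μ i ℚ.≤ 1ℚ)) ×
  Covers Ψ S ×
  (∀ M₁ M₂ → InN^ S M₁ → InN^ S M₂ → Reconf Ψ M₁ M₂ → μM μ M₁ ≡ μM μ M₂)

kα : ∀ {n} → Subset n → (Fin n → ℚ) → MSet n → MSet n → ℚ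
kα S μ M₁ M₂ = μM μ M₁ ℚ.- μM μ (M₂ ∩S S)

lα : ∀ {n} → Subset n → MSet n → MSet n → ℕ
lα S M₁ M₂ = size (M₂ −M (M₂ ∩S S))

_÷ℕ_⟨_⟩ : ℚ → (l : ℕ) → l ≢ 0 → ℚ
q ÷ℕ l ⟨ nz ⟩ = q ℚ.* ℚ.normalize 1 l {{ℕ.≢-nonZero nz}}

StableOnTarget : ∀ {m n} → PolymerSet m n → Subset n → (Fin n → ℚ) → Set
StableOnTarget Ψ S μ =
  ∀ M₁ M₂ → InN^ S M₁ → Reconf Ψ M₁ M₂ →
    (nz : lα S M₁ M₂ ≢ 0) → 1ℚ ℚ.< (kα S μ M₁ M₂ ÷ℕ lα S M₁ M₂ ⟨ nz ⟩)

{-# OPTIONS --safe #-}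
-- With μ ≡ 1 the weight μ(M) is just the size |M|. Every M ∈ ℕ^S is TBN-stable, so two
-- reconfigurations inside ℕ^S bound each other's size and μ is invariant. For a canonical
-- reaction M₁ → M₂ with l ≠ 0, M₂ contains a polymer outside S, so closedness gives
-- |M₂ ∩ S| + l = |M₂| < |M₁|, that is l < |M₁| − |M₂ ∩ S| = k.
module Submission where

open import Defs
open import Data.Nat using (ℕ; zero; suc; _+_; _∸_; _≤_; _<_; s≤s; z≤n)
open import Data.Nat.Properties
  using ( ≤-antisym; ≤-trans; <⇒≤; <⇒≢; m≤n+m; m+n≤o⇒m≤o∸n; m+[n∸m]≡n; n∸n≡0; +-identityʳ
        ; +-commutativeSemigroup)
open import Algebra.Properties.CommutativeSemigroup +-commutativeSemigroup using (interchange)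
open import Data.Fin using (Fin; zero; suc)
open import Data.Fin.Subset using (Subset; _∈_; _∉_)
open import Data.Fin.Subset.Properties using (_∈?_)
open import Data.Bool using (true; false)
open import Data.Product using (_×_; _,_; ∃; proj₁; proj₂)
open import Data.Empty using (⊥-elim)
open import Relation.Nullary using (does; yes; no)
open import Relation.Binary.PropositionalEquality
import Data.Integer as ℤ
import Data.Integer.Properties as ℤₚ
open import Data.Rational as ℚ using (ℚ; 1ℚ; mkℚ; normalize)
import Data.Rational.Properties as ℚₚ
open import Algebra.Properties.AbelianGroup ℚₚ.+-0-abelianGroup using (xyx⁻¹≈y)
open import Data.Nat.Coprimality using (1-coprimeTo) renaming (sym to coprime-sym)

sumFin-cong : ∀ n {f g : Fin n → ℕ} → (∀ i → f i ≡ g i) → sumFin n f ≡ sumFin n g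
sumFin-cong zero    f≗g = refl
sumFin-cong (suc n) f≗g = cong₂ _+_ (f≗g zero) (sumFin-cong n (λ i → f≗g (suc i)))

sumFin-+ : ∀ n (f g : Fin n → ℕ) → sumFin n (λ i → f i + g i) ≡ sumFin n f + sumFin n g
sumFin-+ zero    f g = refl
sumFin-+ (suc n) f g = begin
  f zero + g zero + sumFin n (λ i → f (suc i) + g (suc i))
    ≡⟨ cong (f zero + g zero +_) (sumFin-+ n (λ i → f (suc i)) (λ i → g (suc i))) ⟩
  f zero + g zero + (sumFin n (λ i → f (suc i)) + sumFin n (λ i → g (suc i)))
    ≡⟨ interchange (f zero) (g zero) _ _ ⟩
  f zero + sumFin n (λ i → f (suc i)) + (g zero + sumFin n (λ i → g (suc i))) ∎
  where open ≡-Reasoning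

sumFin≢0⇒∃-positive : ∀ n (f : Fin n → ℕ) → sumFin n f ≢ 0 → ∃ λ i → 1 ≤ f i
sumFin≢0⇒∃-positive zero    f ≢0 = ⊥-elim (≢0 refl)
sumFin≢0⇒∃-positive (suc n) f ≢0 with f zero in eq
... | suc _ = zero , subst (1 ≤_) (sym eq) (s≤s z≤n)
... | zero with sumFin≢0⇒∃-positive n (λ i → f (suc i)) ≢0
...   | i , pos = suc i , pos

−M∩S-+-∩S : ∀ {n} (M : MSet n) S i → (M −M (M ∩S S)) i + (M ∩S S) i ≡ M i
−M∩S-+-∩S M S i with does (i ∈? S)
... | true  = cong (_+ M i) (n∸n≡0 (M i))
... | false = +-identityʳ (M i)

size-−M∩S-+-∩S : ∀ {n} (M : MSet n) S → size (M −M (M ∩S S)) + size (M ∩S S) ≡ size M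
size-−M∩S-+-∩S {n} M S =
  trans (sym (sumFin-+ n (M −M (M ∩S S)) (M ∩S S))) (sumFin-cong n (−M∩S-+-∩S M S))

∈−M∩S⇒∉S : ∀ {n} (M : MSet n) S i → i ∈M (M −M (M ∩S S)) → i ∉ S × i ∈M M
∈−M∩S⇒∉S M S i pos with i ∈? S
... | yes _  = ⊥-elim (<⇒≢ pos (sym (n∸n≡0 (M i))))
... | no i∉S = i∉S , pos

fromℕ : ℕ → ℚ
fromℕ k = ℤ.+ k ℚ./ 1

fromℕ≡mkℚ : ∀ k → fromℕ k ≡ mkℚ (ℤ.+ k) 0 (coprime-sym (1-coprimeTo k))
fromℕ≡mkℚ k = ℚₚ.normalize-coprime (coprime-sym (1-coprimeTo k))

fromℕ-+ : ∀ a b → fromℕ (a + b) ≡ fromℕ a ℚ.+ fromℕ b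
fromℕ-+ a b rewrite fromℕ≡mkℚ a | fromℕ≡mkℚ b =
  cong (ℚ._/ 1) (sym (cong₂ ℤ._+_ (ℤₚ.*-identityʳ (ℤ.+ a)) (ℤₚ.*-identityʳ (ℤ.+ b))))

fromℕ-∸ : ∀ {a b} → b ≤ a → fromℕ (a ∸ b) ≡ fromℕ a ℚ.- fromℕ b
fromℕ-∸ {a} {b} b≤a = begin
  fromℕ (a ∸ b)                         ≡⟨ sym (xyx⁻¹≈y (fromℕ b) (fromℕ (a ∸ b))) ⟩
  fromℕ b ℚ.+ fromℕ (a ∸ b) ℚ.- fromℕ b ≡⟨ cong (ℚ._- fromℕ b) (sym (fromℕ-+ b (a ∸ b))) ⟩
  fromℕ (b + (a ∸ b)) ℚ.- fromℕ b       ≡⟨ cong (λ k → fromℕ k ℚ.- fromℕ b) (m+[n∸m]≡n b≤a) ⟩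
  fromℕ a ℚ.- fromℕ b                   ∎
  where open ≡-Reasoning

fromℕ-mono-< : ∀ {a b} → a < b → fromℕ a ℚ.< fromℕ b
fromℕ-mono-< {a} {b} a<b rewrite fromℕ≡mkℚ a | fromℕ≡mkℚ b =
  ℚ.*<* (subst₂ ℤ._<_ (sym (ℤₚ.*-identityʳ (ℤ.+ a))) (sym (ℤₚ.*-identityʳ (ℤ.+ b))) (ℤ.+<+ a<b))

fromℕ-*-normalize-1 : ∀ k → fromℕ (suc k) ℚ.* normalize 1 (suc k) ≡ 1ℚ
fromℕ-*-normalize-1 k rewrite fromℕ≡mkℚ (suc k) | ℚₚ.normalize-coprime {1} {k} (1-coprimeTo (suc k)) =
  ℚₚ.*-inverseʳ (mkℚ (ℤ.+ suc k) 0 (coprime-sym (1-coprimeTo (suc k))))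

fromℕ<⇒1<÷ℕ : ∀ q l (l≢0 : l ≢ 0) → fromℕ l ℚ.< q → 1ℚ ℚ.< q ÷ℕ l ⟨ l≢0 ⟩
fromℕ<⇒1<÷ℕ q zero    l≢0 _   = ⊥-elim (l≢0 refl)
fromℕ<⇒1<÷ℕ q (suc k) _   l<q = begin-strict
  1ℚ                                    ≡⟨ sym (fromℕ-*-normalize-1 k) ⟩
  fromℕ (suc k) ℚ.* normalize 1 (suc k) <⟨ ℚₚ.*-monoˡ-<-pos _ {{ℚₚ.normalize-pos 1 (suc k)}} l<q ⟩
  q ℚ.* normalize 1 (suc k)             ∎
  where open ℚₚ.≤-Reasoning

μM-1≡fromℕ-size : ∀ {n} (M : MSet n) → μM (λ _ → 1ℚ) M ≡ fromℕ (size M)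
μM-1≡fromℕ-size {zero}  M = refl
μM-1≡fromℕ-size {suc n} M = begin
  fromℕ (M zero) ℚ.* 1ℚ ℚ.+ μM (λ _ → 1ℚ) (λ i → M (suc i))
    ≡⟨ cong₂ ℚ._+_ (ℚₚ.*-identityʳ (fromℕ (M zero))) (μM-1≡fromℕ-size (λ i → M (suc i))) ⟩
  fromℕ (M zero) ℚ.+ fromℕ (size (λ i → M (suc i)))
    ≡⟨ sym (fromℕ-+ (M zero) _) ⟩
  fromℕ (size M) ∎
  where open ≡-Reasoning

module _ {m n} (Ψ : PolymerSet m n) (S : Subset n) (closed : TBNStabilityClosed Ψ S) where

  closed⇒size-≡ : ∀ {M₁ M₂} → InN^ S M₁ → InN^ S M₂ → Reconf Ψ M₁ M₂ → size M₁ ≡ size M₂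
  closed⇒size-≡ {M₁} {M₂} M₁∈S M₂∈S r =
    ≤-antisym (proj₁ closed M₂ M₂∈S M₁ (λ a → sym (r a))) (proj₁ closed M₁ M₁∈S M₂ r)

  closed⇒lα+size∩S<size : ∀ {M₁ M₂} → InN^ S M₁ → Reconf Ψ M₁ M₂ → lα S M₁ M₂ ≢ 0 →
                           lα S M₁ M₂ + size (M₂ ∩S S) < size M₁
  closed⇒lα+size∩S<size {M₁} {M₂} M₁∈S r l≢0 =
    let i , pos = sumFin≢0⇒∃-positive n (M₂ −M (M₂ ∩S S)) l≢0 in
    subst (_< size M₁) (sym (size-−M∩S-+-∩S M₂ S))
          (proj₂ closed M₁ M₂ M₁∈S r (i , ∈−M∩S⇒∉S M₂ S i pos))

  closed⇒fromℕ-lα<kα : ∀ {M₁ M₂} → InN^ S M₁ → Reconf Ψ M₁ M₂ → lα S M₁ M₂ ≢ 0 →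
                        fromℕ (lα S M₁ M₂) ℚ.< kα S (λ _ → 1ℚ) M₁ M₂
  closed⇒fromℕ-lα<kα {M₁} {M₂} M₁∈S r l≢0 = begin-strict
    fromℕ l                     <⟨ fromℕ-mono-< (m+n≤o⇒m≤o∸n (suc l) l+b<a) ⟩
    fromℕ (size M₁ ∸ b)         ≡⟨ fromℕ-∸ (≤-trans (m≤n+m b l) (<⇒≤ l+b<a)) ⟩
    fromℕ (size M₁) ℚ.- fromℕ b ≡⟨ sym (cong₂ ℚ._-_ (μM-1≡fromℕ-size M₁) (μM-1≡fromℕ-size (M₂ ∩S S))) ⟩
    kα S (λ _ → 1ℚ) M₁ M₂       ∎
    where
    open ℚₚ.≤-Reasoning
    l b : ℕ
    l = lα S M₁ M₂
    b = size (M₂ ∩S S)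
    l+b<a : l + b < size M₁
    l+b<a = closed⇒lα+size∩S<size M₁∈S r l≢0

lemma18 : ∀ {m n} (Ψ : PolymerSet m n) (S : Subset n) →
            TBNStabilityClosed Ψ S → Covers Ψ S →
            OnTarget Ψ S (λ _ → 1ℚ) × StableOnTarget Ψ S (λ _ → 1ℚ)
lemma18 Ψ S closed covers = (μ-bounds , covers , μ-invariant) , stable
  where
  μ-bounds : ∀ i → i ∈ S → (ℚ.0ℚ ℚ.< 1ℚ) × (1ℚ ℚ.≤ 1ℚ)
  μ-bounds _ _ = ℚₚ.positive⁻¹ 1ℚ , ℚₚ.≤-refl
  μ-invariant : ∀ M₁ M₂ → InN^ S M₁ → InN^ S M₂ → Reconf Ψ M₁ M₂ → μM (λ _ → 1ℚ) M₁ ≡ μM (λ _ → 1ℚ) M₂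
  μ-invariant M₁ M₂ M₁∈S M₂∈S r = begin
    μM (λ _ → 1ℚ) M₁ ≡⟨ μM-1≡fromℕ-size M₁ ⟩
    fromℕ (size M₁)  ≡⟨ cong fromℕ (closed⇒size-≡ Ψ S closed M₁∈S M₂∈S r) ⟩
    fromℕ (size M₂)  ≡⟨ sym (μM-1≡fromℕ-size M₂) ⟩
    μM (λ _ → 1ℚ) M₂ ∎
    where open ≡-Reasoning
  stable : StableOnTarget Ψ S (λ _ → 1ℚ)
  stable M₁ M₂ M₁∈S r l≢0 =
    fromℕ<⇒1<÷ℕ (kα S (λ _ → 1ℚ) M₁ M₂) (lα S M₁ M₂) l≢0 (closed⇒fromℕ-lα<kα Ψ S closed M₁∈S r l≢0)
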